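{- Let $G$ be a finite simple graph of order $p$ with minimum degree $\delta$ and independence number $\alpha$. If $str(G)=p+\delta$, then $\alpha\ge\left\lceil\frac{p-\delta+1}{2}\right\rceil$.
   Context: For a graph $G$ of order $p$ with at least one edge, a numbering is a bijection $f:V(G)\to\{1,\dots,p\}$; $str_f(G)=\max\{f(u)+f(v): uv\in E(G)\}$ and $str(G)=\min\{str_f(G)\}$ over numberings. -}

module Defs where

open import Data.Nat using (ℕ; suc; _+_; _≤_)
open import Data.Fin using (Fin; toℕ)
open import Data.Fin.Subset using (Subset; _∈_; ∣_∣)
open import Data.Fin.Permutation using (Permutation′; _⟨$⟩ʳ_)
open import Data.List using (List; length; filter; allFin)
open import Data.Product using (Σ; ∃; _×_)
open import Relation.Nullary using (¬_; Dec)
open import Relation.Binary.PropositionalEquality using (_≡_)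

allVertices : (p : ℕ) → List (Fin p)
allVertices p = allFin p

record SimpleGraph (p : ℕ) : Set₁ where
  field
    Adj     : Fin p → Fin p → Set
    adj?    : (u v : Fin p) → Dec (Adj u v)
    symm    : ∀ {u v} → Adj u v → Adj v u
    irrefl  : ∀ {u} → ¬ Adj u u

module _ {p : ℕ} (G : SimpleGraph p) where
  open SimpleGraph G

  HasEdge : Set
  HasEdge = Σ (Fin p) λ u → Σ (Fin p) λ v → Adj u v

  degree : Fin p → ℕ
  degree v = length (filter (adj? v) (allVertices p))

  IsMinDegree : ℕ → Set
  IsMinDegree δ = (∃ λ v → degree v ≡ δ) × (∀ v → δ ≤ degree v)

  Independent : Subset p → Set
  Independent S = ∀ u v → u ∈ S → v ∈ S → ¬ Adj u v

  IsIndependenceNumber : ℕ → Set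
  IsIndependenceNumber α =
    (∃ λ S → Independent S × ∣ S ∣ ≡ α) × (∀ S → Independent S → ∣ S ∣ ≤ α)

  -- label of vertex u under numbering f, in {1,…,p}
  label : Permutation′ p → Fin p → ℕ
  label f u = suc (toℕ (f ⟨$⟩ʳ u))

  StrBound : Permutation′ p → ℕ → Set
  StrBound f t = ∀ u v → Adj u v → label f u + label f v ≤ t

  IsStrF : Permutation′ p → ℕ → Set
  IsStrF f s = (∃ λ u → ∃ λ v → Adj u v × label f u + label f v ≡ s) × StrBound f s

  IsStrength : ℕ → Set
  IsStrength s = (∃ λ f → IsStrF f s) × (∀ f t → IsStrF f t → s ≤ t)

-- Take a numbering f with str_f(G) ≤ p + δ.  The vertices whose labels are at
-- least m form an independent set as soon as p + δ ≤ 2m: two adjacent ones would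
-- have label sum at least 2m, forcing both labels to equal m, so u = v.  Choosing
-- m = p − ⌊(p − δ)/2⌋ leaves ⌊(p − δ)/2⌋ + 1 = ⌈(p − δ + 1)/2⌉ such labels.
module Submission where

open import Defs
open import Data.Nat using (ℕ; _+_; _∸_; _≤_; suc; ⌈_/2⌉)
open import Data.Nat using (zero; s≤s; z≤n; _<_; _≤ᵇ_; ⌊_/2⌋)
open import Data.Nat.Properties
open import Data.Bool using (Bool; true; false; if_then_else_)
open import Data.Bool.Properties using (T-≡)
open import Data.Fin using (Fin; toℕ)
open import Data.Fin.Properties using (toℕ<n; toℕ-injective)
open import Data.Fin.Subset using (Subset; _∈_; ∣_∣)
open import Data.Fin.Permutation using (Permutation′; _⟨$⟩ʳ_)
open import Data.Vec using (tabulate)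
open import Data.Vec.Properties using (lookup∘tabulate; []=⇒lookup)
open import Data.List using (allFin)
open import Data.List.Properties using (length-filter; length-tabulate)
open import Data.Product using (_,_)
open import Function.Bundles using (Injection; Equivalence)
open import Function.Properties.Inverse using (↔⇒↣)
open import Relation.Binary.PropositionalEquality
open import Data.Nat.Solver using (module +-*-Solver)
open import Algebra.Properties.CommutativeMonoid.Sum +-0-commutativeMonoid using (sum; sum-permute)

indicator : Bool → ℕ
indicator b = if b then 1 else 0

∣tabulate∣≡sum-indicator : ∀ {n} (b : Fin n → Bool) →
  ∣ tabulate b ∣ ≡ sum (λ i → indicator (b i))
∣tabulate∣≡sum-indicator {zero}  b = refl
∣tabulate∣≡sum-indicator {suc n} b with b Fin.zero
... | true  = cong suc (∣tabulate∣≡sum-indicator (λ i → b (Fin.suc i)))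
... | false = ∣tabulate∣≡sum-indicator (λ i → b (Fin.suc i))

-- The split on t lets suc t ≤ᵇ suc k reduce to t ≤ᵇ k.
sum-indicator-≤ᵇ : ∀ n t → sum {n} (λ i → indicator (t ≤ᵇ toℕ i)) ≡ n ∸ t
sum-indicator-≤ᵇ zero    t             = sym (0∸n≡0 t)
sum-indicator-≤ᵇ (suc n) zero          = cong suc (sum-indicator-≤ᵇ n zero)
sum-indicator-≤ᵇ (suc n) (suc zero)    = sum-indicator-≤ᵇ n zero
sum-indicator-≤ᵇ (suc n) (suc (suc t)) = sum-indicator-≤ᵇ n (suc t)

≤-squeeze : ∀ {x y m} → x + y ≤ m + m → m ≤ x → m ≤ y → x ≡ m
≤-squeeze {x} {y} {m} x+y≤2m m≤x m≤y =
  ≤-antisym (+-cancelʳ-≤ m x m (≤-trans (+-monoʳ-≤ x m≤y) x+y≤2m)) m≤x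

⌊n/2⌋+⌊n/2⌋≤n : ∀ n → ⌊ n /2⌋ + ⌊ n /2⌋ ≤ n
⌊n/2⌋+⌊n/2⌋≤n n =
  ≤-trans (+-monoʳ-≤ ⌊ n /2⌋ (⌊n/2⌋≤⌈n/2⌉ n)) (≤-reflexive (⌊n/2⌋+⌈n/2⌉≡n n))

⌊n/2⌋<m : ∀ {m n} → 1 ≤ m → n ≤ m → ⌊ n /2⌋ < m
⌊n/2⌋<m {n = zero}  1≤m _   = 1≤m
⌊n/2⌋<m {n = suc n} _   n≤m = ≤-trans (⌊n/2⌋<n n) n≤m

threshold-bound : ∀ {p δ q h t} → δ + q ≡ p → h + h ≤ q → t + suc h ≡ p →
  p + δ ≤ suc t + suc t
threshold-bound {p} {δ} {q} {h} {t} δ+q≡p 2h≤q t+h≡p =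
  +-cancelʳ-≤ (h + h) (p + δ) (suc t + suc t) (begin
    p + δ + (h + h)          ≤⟨ +-monoʳ-≤ (p + δ) 2h≤q ⟩
    p + δ + q                ≡⟨ trans (+-assoc p δ q) (cong (p +_) δ+q≡p) ⟩
    p + p                    ≡⟨ cong₂ _+_ t+h≡p t+h≡p ⟨
    t + suc h + (t + suc h)  ≡⟨ solve 2 (λ t h → t :+ (con 1 :+ h) :+ (t :+ (con 1 :+ h))
                                    := (con 1 :+ t) :+ (con 1 :+ t) :+ (h :+ h)) refl t h ⟩
    suc t + suc t + (h + h)  ∎)
  where
  open ≤-Reasoning
  open +-*-Solver

degree≤order : ∀ {p} (G : SimpleGraph p) v → degree G v ≤ p
degree≤order {p} G v = ≤-trans (length-filter (SimpleGraph.adj? G v) (allFin p))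
                               (≤-reflexive (length-tabulate (λ u → u)))

module _ {p : ℕ} (G : SimpleGraph p) (f : Permutation′ p) where
  open SimpleGraph G

  labelAbove : ℕ → Subset p
  labelAbove t = tabulate λ u → t ≤ᵇ toℕ (f ⟨$⟩ʳ u)

  ∈labelAbove⇒label≥ : ∀ {t u} → u ∈ labelAbove t → suc t ≤ label G f u
  ∈labelAbove⇒label≥ {t} {u} u∈ = s≤s (≤ᵇ⇒≤ t _ (Equivalence.from T-≡ b≡true))
    where
    b≡true : (t ≤ᵇ toℕ (f ⟨$⟩ʳ u)) ≡ true
    b≡true = trans (sym (lookup∘tabulate _ u)) ([]=⇒lookup u∈)

  label-injective : ∀ {u v} → label G f u ≡ label G f v → u ≡ v
  label-injective eq = Injection.injective (↔⇒↣ f) (toℕ-injective (suc-injective eq))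

  labelAbove-independent : ∀ {c t} → StrBound G f c → c ≤ suc t + suc t →
    Independent G (labelAbove t)
  labelAbove-independent {c} {t} bound c≤2[1+t] u v u∈ v∈ uv =
    irrefl (subst (Adj u) (sym u≡v) uv)
    where
    sum≤2[1+t] : label G f u + label G f v ≤ suc t + suc t
    sum≤2[1+t] = ≤-trans (bound u v uv) c≤2[1+t]
    u≡v : u ≡ v
    u≡v = label-injective (trans
      (≤-squeeze sum≤2[1+t] (∈labelAbove⇒label≥ u∈) (∈labelAbove⇒label≥ v∈))
      (sym (≤-squeeze (≤-trans (≤-reflexive (+-comm (label G f v) (label G f u))) sum≤2[1+t])
                      (∈labelAbove⇒label≥ v∈) (∈labelAbove⇒label≥ u∈))))

  ∣labelAbove∣ : ∀ t → ∣ labelAbove t ∣ ≡ p ∸ t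
  ∣labelAbove∣ t = begin
    ∣ labelAbove t ∣                           ≡⟨ ∣tabulate∣≡sum-indicator (λ u → t ≤ᵇ toℕ (f ⟨$⟩ʳ u)) ⟩
    sum (λ u → indicator (t ≤ᵇ toℕ (f ⟨$⟩ʳ u))) ≡⟨ sym (sum-permute (λ i → indicator (t ≤ᵇ toℕ i)) f) ⟩
    sum {p} (λ i → indicator (t ≤ᵇ toℕ i))     ≡⟨ sum-indicator-≤ᵇ p t ⟩
    p ∸ t                                       ∎
    where open ≡-Reasoning

mainTheorem17 : (p : ℕ) (G : SimpleGraph p) (δ α : ℕ) →
    HasEdge G → IsMinDegree G δ → IsIndependenceNumber G α →
    IsStrength G (p + δ) →
    ⌈ suc (p ∸ δ) /2⌉ ≤ α
mainTheorem17 p G δ α (u , _) ((v , degree≡δ) , _) (_ , α-max) ((f , _ , bound) , _) = begin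
  ⌈ suc q /2⌉          ≡⟨ m∸[m∸n]≡n h<p ⟨
  p ∸ t                ≡⟨ ∣labelAbove∣ G f t ⟨
  ∣ labelAbove G f t ∣ ≤⟨ α-max (labelAbove G f t) (labelAbove-independent G f bound threshold) ⟩
  α                    ∎
  where
  open ≤-Reasoning
  q h t : ℕ
  q = p ∸ δ
  -- ⌈ suc q /2⌉ computes to suc h
  h = ⌊ q /2⌋
  t = p ∸ suc h
  δ≤p : δ ≤ p
  δ≤p = subst (_≤ p) degree≡δ (degree≤order G v)
  h<p : suc h ≤ p
  h<p = ⌊n/2⌋<m (≤-trans (s≤s z≤n) (toℕ<n u)) (m∸n≤m p δ)
  threshold : p + δ ≤ suc t + suc t
  threshold = threshold-bound (m+[n∸m]≡n δ≤p) (⌊n/2⌋+⌊n/2⌋≤n q) (m∸n+n≡m h<p)
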